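{- Let $U=\{u_1,\dots,u_n\}$, let $\mathcal{F}$ be a family of subsets of $U$ with characteristic polynomial $p(z)=p_\psi(\mathcal{F})$, and let $\ell\ge1$. For any $W\subseteq U$, $W$ is the disjoint union of $\ell$ sets from $\mathcal{F}$ if and only if the monomial $z^{val(\psi(W))}$ occurs (with nonzero coefficient) in $p(z)^{\ell}$.
   Context: For $S\subseteq U$, $\psi(S)$ is the $n$-bit binary string whose $j$-th bit is 1 iff $u_j\in S$, and $val(\psi(S))$ is the integer it represents. $p_\psi(\mathcal{F})=\sum_{S\in\mathcal{F}} z^{val(\psi(S))}$. The Hamming weight $\mathcal{H}(d)$ of an integer $d\ge0$ is the number of 1s in its binary representation. For $p(z)=\sum_i a_i z^i$: $\mathcal{H}_h(p)=\sum_{i:\mathcal{H}(i)=h} a_i z^i$; the representative polynomial of $p$ is $\sum_i b_i z^i$ with $b_i=1$ if $a_i\ne0$ and $0$ otherwise. For polynomials $q,r$, $q\star r$ is the representative polynomial of $\sum_{i,j\ge0,\ i+j\le n}\mathcal{H}_{i+j}\big(\mathcal{H}_i(q)\cdot\mathcal{H}_j(r)\big)$, with $\cdot$ ordinary multiplication. $p^1=p$ and $p^{\ell}=p^{\ell-1}\star p$ for $\ell\ge2$. -}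

module Defs where

open import Data.Nat using (ℕ; zero; suc; _+_; _*_; _∸_; _^_; _≡ᵇ_)
open import Data.Nat.DivMod using (_%_; _/_)
open import Data.Bool using (Bool; true; false; if_then_else_; _∧_)
open import Data.List using (List; []; _∷_; map; _++_; upTo; concatMap; tabulate)
open import Data.Nat.ListAction using (sum)
open import Data.Vec using (Vec; []; _∷_)
open import Data.Fin using (Fin)
open import Data.Fin.Subset using (Subset; _∩_; ⋃; ⊥)
open import Relation.Binary.PropositionalEquality using (_≡_; _≢_)
open import Data.Product using (Σ; _×_)

-- Universe U = {u_1,...,u_n} is identified with Fin n; a subset S ⊆ U is
-- Subset n = Vec Bool n, whose j-th entry is true iff u_j ∈ S.
-- A family F of subsets of U is given by its (decidable) membership
-- predicate  F : Subset n → Bool.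

-- val (ψ(S)) : the integer represented by the n-bit string ψ(S) = b_1 … b_n,
-- read with b_1 the most significant bit.
val : ∀ {n} → Subset n → ℕ
val {zero}  []       = 0
val {suc n} (b ∷ bs) = (if b then 2 ^ n else 0) + val bs

-- Hamming weight (number of 1s in binary); fuel = d suffices since d/2 < d.
hwAux : ℕ → ℕ → ℕ
hwAux zero    d = 0
hwAux (suc f) d = d % 2 + hwAux f (d / 2)

hw : ℕ → ℕ
hw d = hwAux d d

-- Polynomials in z with ℕ coefficients, represented by their coefficient
-- function: p k is the coefficient of z^k.  (All polynomials built below have
-- finite support; the operations coincide with polynomial operations.)
Poly : Set
Poly = ℕ → ℕ

_·_ : Poly → Poly → Poly
(p · q) k = sum (map (λ i → p i * q (k ∸ i)) (upTo (suc k)))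

Hw : ℕ → Poly → Poly
Hw h p k = if hw k ≡ᵇ h then p k else 0

rep : Poly → Poly
rep p k = if p k ≡ᵇ 0 then 0 else 1

allSubsets : ∀ n → List (Subset n)
allSubsets zero    = [] ∷ []
allSubsets (suc n) = map (true ∷_) (allSubsets n) ++ map (false ∷_) (allSubsets n)

charPoly : ∀ {n} → (Subset n → Bool) → Poly
charPoly {n} F k = sum (map (λ S → if F S ∧ (val S ≡ᵇ k) then 1 else 0) (allSubsets n))

star : ℕ → Poly → Poly → Poly
star n q r = rep (λ k →
  sum (concatMap (λ i → map (λ j → Hw (i + j) (Hw i q · Hw j r) k)
                            (upTo (suc (n ∸ i))))
                 (upTo (suc n))))

-- p^1 = p, p^ℓ = p^{ℓ-1} ⋆ p  (ℓ ≥ 2).  The value at ℓ = 0 is never used.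
power : ℕ → Poly → ℕ → Poly
power n p zero                = λ _ → 0
power n p (suc zero)          = p
power n p (suc (suc ℓ))       = star n (power n p (suc ℓ)) p

IsDisjointUnionOf : ∀ {n} → (Subset n → Bool) → ℕ → Subset n → Set
IsDisjointUnionOf {n} F ℓ W =
  Σ (Fin ℓ → Subset n) λ S →
    ((i : Fin ℓ) → F (S i) ≡ true) ×
    (((i j : Fin ℓ) → i ≢ j → S i ∩ S j ≡ ⊥) ×
    (⋃ (tabulate S) ≡ W))

-- Identify a subset S with the number val S < 2 ^ n, whose Hamming weight is ∣ S ∣. In the binary
-- addition val A + val B = val W every carry merges two 1 bits into one, so ∣ A ∣ + ∣ B ∣ ≥ ∣ W ∣, with
-- equality exactly when the addition is carry-free, that is, when A and B are disjoint with union W.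
-- The coefficients are natural numbers, so nothing cancels: the support of p ^ (ℓ + 1) = p ^ ℓ ⋆ p is the
-- set of sums i + j of an exponent i of p ^ ℓ and an exponent j of p with hw i + hw j = hw (i + j) ≤ n.
-- Induction on ℓ then matches these exponents with the disjoint unions of ℓ + 1 sets from the family.
module Submission where

open import Defs
open import Data.Nat using (ℕ; zero; suc; _+_; _*_; _∸_; _^_; _≤_; _<_; _≡ᵇ_; s≤s; z≤n; NonZero; _<?_)
open import Data.Nat.Properties
open import Data.Nat.DivMod
open import Data.Nat.ListAction using (sum)
open import Data.Nat.Tactic.RingSolver using (solve-∀)
open import Data.Bool using (Bool; true; false; T; _∧_; _∨_; if_then_else_)
open import Data.Bool.Properties using (T-∧; T-≡)
open import Data.Empty using (⊥-elim)
open import Data.Sum using ([_,_]′)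
open import Data.Product using (Σ-syntax; ∃₂; ∃-syntax; _×_; _,_; proj₁; proj₂)
open import Data.Product.Function.NonDependent.Propositional using (_×-⇔_)
open import Data.Vec using ([]; _∷_)
open import Data.Vec.Properties using (∷-injectiveʳ)
open import Data.List using (List; []; _∷_; map; upTo; concatMap; tabulate)
open import Data.List.Relation.Unary.Any using (Any; here; there; satisfied)
import Data.List.Relation.Unary.Any.Properties as Any
open import Data.List.Membership.Propositional using (_∈_; lose)
open import Data.List.Membership.Propositional.Properties using (∈-map⁺; ∈-++⁺ˡ; ∈-++⁺ʳ)
open import Data.Fin using (Fin) renaming (zero to fzero; suc to fsuc)
open import Data.Fin.Properties using () renaming (suc-injective to fsuc-injective)
open import Data.Fin.Subset using (Subset; _∩_; _∪_; ⊥; ⋃; ∣_∣)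
open import Data.Fin.Subset.Properties
  using (∣⊥∣≡0; ∣p∣≤n; ∩-comm; ∪-comm; ∩-distribˡ-∪; ∪-identityˡ; ∪-identityʳ; ∩-zeroʳ)
open import Function using (id; _∘_)
open import Function.Bundles using (_⇔_; mk⇔; Equivalence)
open import Function.Properties.Equivalence using () renaming (trans to ⇔-trans; sym to ⇔-sym)
open import Relation.Binary.PropositionalEquality
open import Relation.Nullary using (yes; no)

open Equivalence using (to; from)

2^n≢0 : ∀ n → NonZero (2 ^ n)
2^n≢0 n = m^n≢0 2 n

bit : Bool → ℕ
bit true  = 1
bit false = 0

bit-injective : ∀ {a b} → bit a ≡ bit b → a ≡ b
bit-injective {true}  {true}  _ = refl
bit-injective {false} {false} _ = refl

val-∷ : ∀ {n} b (S : Subset n) → val (b ∷ S) ≡ val S + bit b * 2 ^ n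
val-∷ true  S = trans (+-comm _ (val S)) (cong (val S +_) (sym (*-identityˡ _)))
val-∷ false S = sym (+-identityʳ (val S))

∣∷∣ : ∀ {n} b (S : Subset n) → ∣ b ∷ S ∣ ≡ bit b + ∣ S ∣
∣∷∣ true  S = refl
∣∷∣ false S = refl

val-⊥ : ∀ {n} → val (⊥ {n}) ≡ 0
val-⊥ {zero}  = refl
val-⊥ {suc n} = val-⊥ {n}

val<2^n : ∀ {n} (S : Subset n) → val S < 2 ^ n
val<2^n []                = s≤s z≤n
val<2^n {suc n} (true ∷ S)  = +-monoʳ-< (2 ^ n) (<-≤-trans (val<2^n S) (m≤m+n (2 ^ n) 0))
val<2^n {suc n} (false ∷ S) = <-≤-trans (val<2^n S) (m≤m+n (2 ^ n) (2 ^ n + 0))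

[r+qM]%M≡r : ∀ {M} .{{_ : NonZero M}} {r} q → r < M → (r + q * M) % M ≡ r
[r+qM]%M≡r {M} {r} q r<M = trans ([m+kn]%n≡m%n r q M) (m<n⇒m%n≡m r<M)

[r+qM]/M≡q : ∀ {M} .{{_ : NonZero M}} {r} q → r < M → (r + q * M) / M ≡ q
[r+qM]/M≡q {M} {r} q r<M = begin
  (r + q * M) / M    ≡⟨ +-distrib-/ r (q * M) no-carry ⟩
  r / M + q * M / M  ≡⟨ cong₂ _+_ (m<n⇒m/n≡0 r<M) (m*n/n≡m q M) ⟩
  q                  ∎
  where
  open ≡-Reasoning
  no-carry : r % M + q * M % M < M
  no-carry = subst₂ (λ x y → x + y < M) (sym (m<n⇒m%n≡m r<M)) (sym (m*n%n≡0 q M))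
                    (subst (_< M) (sym (+-identityʳ r)) r<M)

divMod-unique : ∀ {M} .{{_ : NonZero M}} {q q′ r r′} → r < M → r′ < M →
                r + q * M ≡ r′ + q′ * M → q ≡ q′ × r ≡ r′
divMod-unique {q = q} {q′} r<M r′<M eq =
  trans (sym ([r+qM]/M≡q q r<M)) (trans (/-congˡ eq) ([r+qM]/M≡q q′ r′<M)) ,
  trans (sym ([r+qM]%M≡r q r<M)) (trans (%-congˡ eq) ([r+qM]%M≡r q′ r′<M))

val-injective : ∀ {n} {A B : Subset n} → val A ≡ val B → A ≡ B
val-injective {A = []} {[]} _ = refl
val-injective {suc n} {a ∷ A} {b ∷ B} eq =
  cong₂ _∷_ (bit-injective (proj₁ parts)) (val-injective (proj₂ parts))
  where
  parts : bit a ≡ bit b × val A ≡ val B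
  parts = divMod-unique {{2^n≢0 n}} (val<2^n A) (val<2^n B)
                        (trans (sym (val-∷ a A)) (trans eq (val-∷ b B)))

val-surjective : ∀ n {a} → a < 2 ^ n → Σ[ S ∈ Subset n ] val S ≡ a
val-surjective zero {zero} _ = [] , refl
val-surjective zero {suc a} (s≤s ())
val-surjective (suc n) {a} a<2M with a <? 2 ^ n
... | yes a<M = let S , e = val-surjective n a<M in false ∷ S , e
... | no a≮M = true ∷ S , trans (cong (2 ^ n +_) e) (m+[n∸m]≡n M≤a)
  where
  M≤a : 2 ^ n ≤ a
  M≤a = ≮⇒≥ a≮M
  a∸M<M : a ∸ 2 ^ n < 2 ^ n
  a∸M<M = subst (a ∸ 2 ^ n <_) (trans (m+n∸m≡n (2 ^ n) (2 ^ n + 0)) (+-identityʳ _))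
                (∸-monoˡ-< a<2M M≤a)
  S : Subset n
  S = proj₁ (val-surjective n a∸M<M)
  e : val S ≡ a ∸ 2 ^ n
  e = proj₂ (val-surjective n a∸M<M)

carry-step : ∀ {n} a b w (A B W : Subset n) c →
             val (a ∷ A) + val (b ∷ B) ≡ val (w ∷ W) + c * 2 ^ suc n →
             ∃[ c′ ] bit a + bit b + c′ ≡ bit w + 2 * c × val A + val B ≡ val W + c′ * 2 ^ n
carry-step {n} a b w A B W c eq = c′ , proj₁ parts , trans s≡ (cong (_+ c′ * M) (proj₂ parts))
  where
  instance
    _ : NonZero (2 ^ n)
    _ = 2^n≢0 n
  M s c′ : ℕ
  M = 2 ^ n
  s = val A + val B
  c′ = s / M
  s≡ : s ≡ s % M + c′ * M
  s≡ = m≡m%n+[m/n]*n s M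
  regroupˡ : ∀ x y r q M → r + (x + y + q) * M ≡ (r + q * M) + x * M + y * M
  regroupˡ = solve-∀
  regroupʳ : ∀ v x c M → v + x * M + c * (2 * M) ≡ v + (x + 2 * c) * M
  regroupʳ = solve-∀
  interchange : ∀ u v x y → u + v + x + y ≡ (u + x) + (v + y)
  interchange = solve-∀
  parts : bit a + bit b + c′ ≡ bit w + 2 * c × s % M ≡ val W
  parts = divMod-unique (m%n<n s M) (val<2^n W) (begin
    s % M + (bit a + bit b + c′) * M            ≡⟨ regroupˡ (bit a) (bit b) (s % M) c′ M ⟩
    (s % M + c′ * M) + bit a * M + bit b * M    ≡⟨ cong (λ x → x + bit a * M + bit b * M) (sym s≡) ⟩
    val A + val B + bit a * M + bit b * M       ≡⟨ interchange (val A) (val B) _ _ ⟩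
    (val A + bit a * M) + (val B + bit b * M)   ≡⟨ sym (cong₂ _+_ (val-∷ a A) (val-∷ b B)) ⟩
    val (a ∷ A) + val (b ∷ B)                   ≡⟨ eq ⟩
    val (w ∷ W) + c * (2 * M)                   ≡⟨ cong (_+ c * (2 * M)) (val-∷ w W) ⟩
    val W + bit w * M + c * (2 * M)             ≡⟨ regroupʳ (val W) (bit w) c M ⟩
    val W + (bit w + 2 * c) * M                 ∎)
    where open ≡-Reasoning

carries-add-up : ∀ a b w c c′ A B W e → a + b + c′ ≡ w + 2 * c → A + B ≡ W + 2 * c′ + e →
                 (a + A) + (b + B) ≡ (w + W) + 2 * c + (c′ + e)
carries-add-up a b w c c′ A B W e head tail = +-cancelˡ-≡ c′ _ _ (begin
  c′ + ((a + A) + (b + B))          ≡⟨ regroupˡ a A b B c′ ⟩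
  (a + b + c′) + (A + B)            ≡⟨ cong₂ _+_ head tail ⟩
  (w + 2 * c) + (W + 2 * c′ + e)    ≡⟨ regroupʳ w c W c′ e ⟩
  c′ + ((w + W) + 2 * c + (c′ + e)) ∎)
  where
  open ≡-Reasoning
  regroupˡ : ∀ a A b B c′ → c′ + ((a + A) + (b + B)) ≡ (a + b + c′) + (A + B)
  regroupˡ = solve-∀
  regroupʳ : ∀ w c W c′ e → (w + 2 * c) + (W + 2 * c′ + e) ≡ c′ + ((w + W) + 2 * c + (c′ + e))
  regroupʳ = solve-∀

-- e counts the carries between positions; the carry c out of the top position accounts for 2 * c.
count-excess : ∀ {n} (A B W : Subset n) c → val A + val B ≡ val W + c * 2 ^ n →
               ∃[ e ] ∣ A ∣ + ∣ B ∣ ≡ ∣ W ∣ + 2 * c + e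
count-excess [] [] [] c eq = 0 , cong (λ x → 2 * x + 0) (sym c≡0)
  where
  c≡0 : c ≡ 0
  c≡0 = trans (sym (*-identityʳ c)) (sym eq)
count-excess (a ∷ A) (b ∷ B) (w ∷ W) c eq =
  let c′ , head , tail = carry-step a b w A B W c eq
      e , excess      = count-excess A B W c′ tail
  in c′ + e , subst₂ (λ x y → x ≡ y + 2 * c + (c′ + e))
                     (sym (cong₂ _+_ (∣∷∣ a A) (∣∷∣ b B))) (sym (∣∷∣ w W))
                     (carries-add-up (bit a) (bit b) (bit w) c c′ (∣ A ∣) (∣ B ∣) (∣ W ∣) e head excess)

bits-disjoint-union : ∀ a b w → bit a + bit b ≡ bit w → a ∧ b ≡ false × a ∨ b ≡ w
bits-disjoint-union true  false true  _ = refl , refl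
bits-disjoint-union false true  true  _ = refl , refl
bits-disjoint-union false false false _ = refl , refl

exact-count⇒disjoint-union : ∀ {n} (A B W : Subset n) → val A + val B ≡ val W →
                             ∣ A ∣ + ∣ B ∣ ≡ ∣ W ∣ → A ∩ B ≡ ⊥ × A ∪ B ≡ W
exact-count⇒disjoint-union [] [] [] _ _ = refl , refl
exact-count⇒disjoint-union {suc n} (a ∷ A) (b ∷ B) (w ∷ W) vals counts
  with carry-step a b w A B W 0 (trans vals (sym (+-identityʳ _)))
... | c′ , head , tail with count-excess A B W c′ tail
... | e , excess =
  cong₂ _∷_ (proj₁ heads) (proj₁ tails) , cong₂ _∷_ (proj₂ heads) (proj₂ tails)
  where
  open ≡-Reasoning
  x : ℕ
  x = bit w + ∣ W ∣
  no-excess : c′ + e ≡ 0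
  no-excess = +-cancelˡ-≡ x _ _ (begin
    x + (c′ + e)                      ≡⟨ cong (_+ (c′ + e)) (+-identityʳ x) ⟨
    x + 0 + (c′ + e)                  ≡⟨ carries-add-up (bit a) (bit b) (bit w) 0 c′ (∣ A ∣) (∣ B ∣) (∣ W ∣) e
                                                        head excess ⟨
    (bit a + ∣ A ∣) + (bit b + ∣ B ∣) ≡⟨ cong₂ _+_ (∣∷∣ a A) (∣∷∣ b B) ⟨
    ∣ a ∷ A ∣ + ∣ b ∷ B ∣              ≡⟨ trans counts (∣∷∣ w W) ⟩
    x                                 ≡⟨ +-identityʳ x ⟨
    x + 0                             ∎)
  c′≡0 : c′ ≡ 0
  c′≡0 = m+n≡0⇒m≡0 c′ no-excess
  e≡0 : e ≡ 0
  e≡0 = m+n≡0⇒n≡0 c′ no-excess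
  heads : a ∧ b ≡ false × a ∨ b ≡ w
  heads = bits-disjoint-union a b w (begin
    bit a + bit b       ≡⟨ +-identityʳ _ ⟨
    bit a + bit b + 0   ≡⟨ cong (bit a + bit b +_) c′≡0 ⟨
    bit a + bit b + c′  ≡⟨ head ⟩
    bit w + 0           ≡⟨ +-identityʳ _ ⟩
    bit w               ∎)
  tails : A ∩ B ≡ ⊥ × A ∪ B ≡ W
  tails = exact-count⇒disjoint-union A B W
    (trans tail (trans (cong (λ y → val W + y * 2 ^ n) c′≡0) (+-identityʳ _)))
    (trans excess (trans (cong₂ (λ y z → ∣ W ∣ + 2 * y + z) c′≡0 e≡0)
                         (trans (+-identityʳ _) (+-identityʳ _))))

bit-∨-∧ : ∀ a b → bit a + bit b ≡ bit (a ∨ b) + bit (a ∧ b)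
bit-∨-∧ true  true  = refl
bit-∨-∧ true  false = refl
bit-∨-∧ false b     = +-comm 0 (bit b)

val-∪-∩ : ∀ {n} (A B : Subset n) → val A + val B ≡ val (A ∪ B) + val (A ∩ B)
val-∪-∩ [] [] = refl
val-∪-∩ {suc n} (a ∷ A) (b ∷ B) = begin
  val (a ∷ A) + val (b ∷ B)
    ≡⟨ cong₂ _+_ (val-∷ a A) (val-∷ b B) ⟩
  (val A + bit a * M) + (val B + bit b * M)
    ≡⟨ regroup (val A) (val B) (bit a) (bit b) M ⟩
  (val A + val B) + (bit a + bit b) * M
    ≡⟨ cong₂ (λ x y → x + y * M) (val-∪-∩ A B) (bit-∨-∧ a b) ⟩
  (val (A ∪ B) + val (A ∩ B)) + (bit (a ∨ b) + bit (a ∧ b)) * M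
    ≡⟨ regroup (val (A ∪ B)) (val (A ∩ B)) (bit (a ∨ b)) (bit (a ∧ b)) M ⟨
  (val (A ∪ B) + bit (a ∨ b) * M) + (val (A ∩ B) + bit (a ∧ b) * M)
    ≡⟨ cong₂ _+_ (val-∷ (a ∨ b) (A ∪ B)) (val-∷ (a ∧ b) (A ∩ B)) ⟨
  val ((a ∷ A) ∪ (b ∷ B)) + val ((a ∷ A) ∩ (b ∷ B))
    ∎
  where
  open ≡-Reasoning
  M = 2 ^ n
  regroup : ∀ u v x y M → (u + x * M) + (v + y * M) ≡ (u + v) + (x + y) * M
  regroup = solve-∀

∣∪∣+∣∩∣ : ∀ {n} (A B : Subset n) → ∣ A ∣ + ∣ B ∣ ≡ ∣ A ∪ B ∣ + ∣ A ∩ B ∣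
∣∪∣+∣∩∣ [] [] = refl
∣∪∣+∣∩∣ (a ∷ A) (b ∷ B) = begin
  ∣ a ∷ A ∣ + ∣ b ∷ B ∣
    ≡⟨ cong₂ _+_ (∣∷∣ a A) (∣∷∣ b B) ⟩
  (bit a + ∣ A ∣) + (bit b + ∣ B ∣)
    ≡⟨ regroup (bit a) (∣ A ∣) (bit b) (∣ B ∣) ⟩
  (bit a + bit b) + (∣ A ∣ + ∣ B ∣)
    ≡⟨ cong₂ _+_ (bit-∨-∧ a b) (∣∪∣+∣∩∣ A B) ⟩
  (bit (a ∨ b) + bit (a ∧ b)) + (∣ A ∪ B ∣ + ∣ A ∩ B ∣)
    ≡⟨ regroup (bit (a ∨ b)) (∣ A ∪ B ∣) (bit (a ∧ b)) (∣ A ∩ B ∣) ⟨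
  (bit (a ∨ b) + ∣ A ∪ B ∣) + (bit (a ∧ b) + ∣ A ∩ B ∣)
    ≡⟨ cong₂ _+_ (∣∷∣ (a ∨ b) (A ∪ B)) (∣∷∣ (a ∧ b) (A ∩ B)) ⟨
  ∣ (a ∷ A) ∪ (b ∷ B) ∣ + ∣ (a ∷ A) ∩ (b ∷ B) ∣
    ∎
  where
  open ≡-Reasoning
  regroup : ∀ x X y Y → (x + X) + (y + Y) ≡ (x + y) + (X + Y)
  regroup = solve-∀

val-disjoint-∪ : ∀ {n} {A B : Subset n} → A ∩ B ≡ ⊥ → val A + val B ≡ val (A ∪ B)
val-disjoint-∪ {n} {A} {B} A∩B≡⊥ = begin
  val A + val B              ≡⟨ val-∪-∩ A B ⟩
  val (A ∪ B) + val (A ∩ B)  ≡⟨ cong (λ S → val (A ∪ B) + val S) A∩B≡⊥ ⟩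
  val (A ∪ B) + val (⊥ {n})  ≡⟨ cong (val (A ∪ B) +_) (val-⊥ {n}) ⟩
  val (A ∪ B) + 0            ≡⟨ +-identityʳ _ ⟩
  val (A ∪ B)                ∎
  where open ≡-Reasoning

∣disjoint-∪∣ : ∀ {n} {A B : Subset n} → A ∩ B ≡ ⊥ → ∣ A ∣ + ∣ B ∣ ≡ ∣ A ∪ B ∣
∣disjoint-∪∣ {n} {A} {B} A∩B≡⊥ = begin
  ∣ A ∣ + ∣ B ∣              ≡⟨ ∣∪∣+∣∩∣ A B ⟩
  ∣ A ∪ B ∣ + ∣ A ∩ B ∣      ≡⟨ cong (λ S → ∣ A ∪ B ∣ + ∣ S ∣) A∩B≡⊥ ⟩
  ∣ A ∪ B ∣ + ∣ ⊥ {n} ∣      ≡⟨ cong (∣ A ∪ B ∣ +_) (∣⊥∣≡0 n) ⟩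
  ∣ A ∪ B ∣ + 0              ≡⟨ +-identityʳ _ ⟩
  ∣ A ∪ B ∣                  ∎
  where open ≡-Reasoning

disjoint-union⇔val-count : ∀ {n} (A B W : Subset n) →
  (A ∩ B ≡ ⊥ × A ∪ B ≡ W) ⇔ (val A + val B ≡ val W × ∣ A ∣ + ∣ B ∣ ≡ ∣ W ∣)
disjoint-union⇔val-count A B W = mk⇔
  (λ (A∩B≡⊥ , A∪B≡W) → trans (val-disjoint-∪ A∩B≡⊥) (cong val A∪B≡W) ,
                        trans (∣disjoint-∪∣ A∩B≡⊥) (cong ∣_∣ A∪B≡W))
  (λ (vals , counts) → exact-count⇒disjoint-union A B W vals counts)

hwAux-0 : ∀ f → hwAux f 0 ≡ 0
hwAux-0 zero    = refl
hwAux-0 (suc f) = hwAux-0 f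

hwAux-fuel : ∀ f g d → d ≤ f → d ≤ g → hwAux f d ≡ hwAux g d
hwAux-fuel f g zero _ _ = trans (hwAux-0 f) (sym (hwAux-0 g))
hwAux-fuel (suc f) (suc g) (suc d) d<f d<g =
  cong (suc d % 2 +_) (hwAux-fuel f g (suc d / 2) (half<fuel d<f) (half<fuel d<g))
  where
  half<fuel : ∀ {h} → suc d ≤ suc h → suc d / 2 ≤ h
  half<fuel d≤h = ≤-pred (<-≤-trans (m/n<m (suc d) 2 (s≤s (s≤s z≤n))) d≤h)

hw-step : ∀ x → hw x ≡ x % 2 + hw (x / 2)
hw-step zero    = refl
hw-step (suc d) = cong (suc d % 2 +_) (hwAux-fuel d (suc d / 2) (suc d / 2) half≤d ≤-refl)
  where
  half≤d : suc d / 2 ≤ d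
  half≤d = ≤-pred (m/n<m (suc d) 2 (s≤s (s≤s z≤n)))

hw-double : ∀ r x → r < 2 → hw (r + x * 2) ≡ r + hw x
hw-double r x r<2 =
  trans (hw-step (r + x * 2)) (cong₂ (λ u v → u + hw v) ([r+qM]%M≡r x r<2) ([r+qM]/M≡q x r<2))

hw-+-bit*2^ : ∀ m b {y} → y < 2 ^ m → hw (y + bit b * 2 ^ m) ≡ bit b + hw y
hw-+-bit*2^ zero true  {zero} _ = refl
hw-+-bit*2^ zero false {zero} _ = refl
hw-+-bit*2^ zero _     {suc _} (s≤s ())
hw-+-bit*2^ (suc m) b {y} y<2^m+1 = begin
  hw (y + bit b * 2 ^ suc m)             ≡⟨ cong hw shift ⟩
  hw (r + (q + bit b * 2 ^ m) * 2)       ≡⟨ hw-double r (q + bit b * 2 ^ m) (m%n<n y 2) ⟩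
  r + hw (q + bit b * 2 ^ m)             ≡⟨ cong (r +_) (hw-+-bit*2^ m b q<2^m) ⟩
  r + (bit b + hw q)                     ≡⟨ +-comm-middle r (bit b) (hw q) ⟩
  bit b + (r + hw q)                     ≡⟨ cong (bit b +_) (hw-step y) ⟨
  bit b + hw y                           ∎
  where
  open ≡-Reasoning
  r q : ℕ
  r = y % 2
  q = y / 2
  q<2^m : q < 2 ^ m
  q<2^m = m<n*o⇒m/o<n (subst (y <_) (*-comm 2 (2 ^ m)) y<2^m+1)
  regroup : ∀ r q B P → (r + q * 2) + B * (2 * P) ≡ r + (q + B * P) * 2
  regroup = solve-∀
  shift : y + bit b * 2 ^ suc m ≡ r + (q + bit b * 2 ^ m) * 2
  shift = trans (cong (_+ bit b * 2 ^ suc m) (m≡m%n+[m/n]*n y 2)) (regroup r q (bit b) (2 ^ m))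
  +-comm-middle : ∀ x y z → x + (y + z) ≡ y + (x + z)
  +-comm-middle = solve-∀

hw-val : ∀ {n} (S : Subset n) → hw (val S) ≡ ∣ S ∣
hw-val []      = refl
hw-val {suc n} (b ∷ S) = begin
  hw (val (b ∷ S))          ≡⟨ cong hw (val-∷ b S) ⟩
  hw (val S + bit b * 2 ^ n) ≡⟨ hw-+-bit*2^ n b (val<2^n S) ⟩
  bit b + hw (val S)        ≡⟨ cong (bit b +_) (hw-val S) ⟩
  bit b + ∣ S ∣              ≡⟨ ∣∷∣ b S ⟨
  ∣ b ∷ S ∣                  ∎
  where open ≡-Reasoning

hw-val≤n : ∀ {n} (S : Subset n) → hw (val S) ≤ n
hw-val≤n S = subst (_≤ _) (sym (hw-val S)) (∣p∣≤n S)

disjoint-split⇔carry-free-split : ∀ {n} (P Q : ℕ → Set) (W : Subset n) →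
  (∃₂ λ A B → P (val A) × Q (val B) × A ∩ B ≡ ⊥ × A ∪ B ≡ W) ⇔
  (∃[ a ] a ≤ val W × hw a + hw (val W ∸ a) ≡ hw (val W) × P a × Q (val W ∸ a))
disjoint-split⇔carry-free-split {n} P Q W = mk⇔ exponents subsets
  where
  exponents : (∃₂ λ A B → P (val A) × Q (val B) × A ∩ B ≡ ⊥ × A ∪ B ≡ W) →
              ∃[ a ] a ≤ val W × hw a + hw (val W ∸ a) ≡ hw (val W) × P a × Q (val W ∸ a)
  exponents (A , B , pA , qB , AB) =
    val A , subst (val A ≤_) vals (m≤m+n (val A) (val B)) , hws , pA , subst Q (sym W∸A) qB
    where
    open ≡-Reasoning
    additive : val A + val B ≡ val W × ∣ A ∣ + ∣ B ∣ ≡ ∣ W ∣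
    additive = to (disjoint-union⇔val-count A B W) AB
    vals : val A + val B ≡ val W
    vals = proj₁ additive
    W∸A : val W ∸ val A ≡ val B
    W∸A = trans (cong (_∸ val A) (sym vals)) (m+n∸m≡n (val A) (val B))
    hws : hw (val A) + hw (val W ∸ val A) ≡ hw (val W)
    hws = begin
      hw (val A) + hw (val W ∸ val A) ≡⟨ cong (λ b → hw (val A) + hw b) W∸A ⟩
      hw (val A) + hw (val B)         ≡⟨ cong₂ _+_ (hw-val A) (hw-val B) ⟩
      ∣ A ∣ + ∣ B ∣                    ≡⟨ proj₂ additive ⟩
      ∣ W ∣                            ≡⟨ hw-val W ⟨
      hw (val W)                      ∎
  subsets : (∃[ a ] a ≤ val W × hw a + hw (val W ∸ a) ≡ hw (val W) × P a × Q (val W ∸ a)) →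
            ∃₂ λ A B → P (val A) × Q (val B) × A ∩ B ≡ ⊥ × A ∪ B ≡ W
  subsets (a , a≤W , hws , pa , qb)
    with A , A≡a   ← val-surjective n (≤-<-trans a≤W (val<2^n W))
       | B , B≡W∸a ← val-surjective n (≤-<-trans (m∸n≤m (val W) a) (val<2^n W)) =
    A , B , subst P (sym A≡a) pa , subst Q (sym B≡W∸a) qb ,
    from (disjoint-union⇔val-count A B W) (vals , counts)
    where
    open ≡-Reasoning
    vals : val A + val B ≡ val W
    vals = trans (cong₂ _+_ A≡a B≡W∸a) (m+[n∸m]≡n a≤W)
    counts : ∣ A ∣ + ∣ B ∣ ≡ ∣ W ∣
    counts = begin
      ∣ A ∣ + ∣ B ∣                  ≡⟨ cong₂ _+_ (hw-val A) (hw-val B) ⟨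
      hw (val A) + hw (val B)       ≡⟨ cong₂ (λ x y → hw x + hw y) A≡a B≡W∸a ⟩
      hw a + hw (val W ∸ a)         ≡⟨ hws ⟩
      hw (val W)                    ≡⟨ hw-val W ⟩
      ∣ W ∣                          ∎

sum≢0⇔ : ∀ xs → sum xs ≢ 0 ⇔ Any (_≢ 0) xs
sum≢0⇔ xs = mk⇔ (some-term≢0 xs) some-term⇒sum≢0
  where
  some-term≢0 : ∀ xs → sum xs ≢ 0 → Any (_≢ 0) xs
  some-term≢0 []           sum≢0 = ⊥-elim (sum≢0 refl)
  some-term≢0 (zero ∷ xs)  sum≢0 = there (some-term≢0 xs sum≢0)
  some-term≢0 (suc _ ∷ xs) _     = here (λ ())
  some-term⇒sum≢0 : ∀ {xs} → Any (_≢ 0) xs → sum xs ≢ 0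
  some-term⇒sum≢0             (here x≢0) = x≢0 ∘ m+n≡0⇒m≡0 _
  some-term⇒sum≢0 {x ∷ _}     (there p)  = some-term⇒sum≢0 p ∘ m+n≡0⇒n≡0 x

any-map-upTo⇔ : ∀ {P : ℕ → Set} (f : ℕ → ℕ) m → Any P (map f (upTo m)) ⇔ (∃[ i ] i < m × P (f i))
any-map-upTo⇔ f m = mk⇔ (Any.applyUpTo⁻ id ∘ Any.map⁻)
                        (λ (i , i<m , p) → Any.map⁺ (Any.applyUpTo⁺ id p i<m))

sum-map-upTo≢0⇔ : ∀ (f : ℕ → ℕ) m → sum (map f (upTo m)) ≢ 0 ⇔ (∃[ i ] i < m × f i ≢ 0)
sum-map-upTo≢0⇔ f m = ⇔-trans (sum≢0⇔ _) (any-map-upTo⇔ f m)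

*≢0⇔ : ∀ m n → m * n ≢ 0 ⇔ (m ≢ 0 × n ≢ 0)
*≢0⇔ m n = mk⇔ (λ mn≢0 → (λ m≡0 → mn≢0 (cong (_* n) m≡0)) ,
                         (λ n≡0 → mn≢0 (trans (cong (m *_) n≡0) (*-zeroʳ m))))
               (λ (m≢0 , n≢0) → [ m≢0 , n≢0 ]′ ∘ m*n≡0⇒m≡0∨n≡0 m)

rep≢0⇔ : ∀ p k → rep p k ≢ 0 ⇔ p k ≢ 0
rep≢0⇔ p k with p k
... | zero  = mk⇔ id id
... | suc _ = mk⇔ (λ _ ()) (λ _ ())

Hw≢0⇔ : ∀ h p k → Hw h p k ≢ 0 ⇔ (hw k ≡ h × p k ≢ 0)
Hw≢0⇔ h p k with hw k ≡ᵇ h in weight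
... | true  = mk⇔ (λ pk≢0 → ≡ᵇ⇒≡ (hw k) h (subst T (sym weight) _) , pk≢0) proj₂
... | false = mk⇔ (λ 0≢0 → ⊥-elim (0≢0 refl))
                  (λ (hw≡h , _) → ⊥-elim (subst T weight (≡⇒≡ᵇ (hw k) h hw≡h)))

·≢0⇔ : ∀ p q k → (p · q) k ≢ 0 ⇔ (∃[ a ] a ≤ k × p a ≢ 0 × q (k ∸ a) ≢ 0)
·≢0⇔ p q k = ⇔-trans (sum-map-upTo≢0⇔ (λ a → p a * q (k ∸ a)) (suc k))
                     (mk⇔ (λ (a , a<1+k , pq≢0) → a , ≤-pred a<1+k , to (*≢0⇔ _ _) pq≢0)
                          (λ (a , a≤k , nz) → a , s≤s a≤k , from (*≢0⇔ _ _) nz))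

∈-allSubsets : ∀ {n} (S : Subset n) → S ∈ allSubsets n
∈-allSubsets []                = here refl
∈-allSubsets {suc n} (true ∷ S)  = ∈-++⁺ˡ (∈-map⁺ (true ∷_) (∈-allSubsets S))
∈-allSubsets {suc n} (false ∷ S) = ∈-++⁺ʳ (map (true ∷_) (allSubsets n)) (∈-map⁺ (false ∷_) (∈-allSubsets S))

indicator≢0⇔ : ∀ b → (if b then 1 else 0) ≢ 0 ⇔ T b
indicator≢0⇔ true  = mk⇔ _ (λ _ ())
indicator≢0⇔ false = mk⇔ (λ 0≢0 → 0≢0 refl) (λ ())

charPoly≢0⇔ : ∀ {n} (F : Subset n → Bool) k → charPoly F k ≢ 0 ⇔ (∃[ S ] F S ≡ true × val S ≡ k)
charPoly≢0⇔ F k = ⇔-trans (sum≢0⇔ _) (mk⇔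
  (λ some → let S , nz = satisfied (Any.map⁻ some) in S , to (term≢0⇔ S) nz)
  (λ (S , member) → Any.map⁺ (lose (∈-allSubsets S) (from (term≢0⇔ S) member))))
  where
  term≢0⇔ : ∀ S → (if F S ∧ (val S ≡ᵇ k) then 1 else 0) ≢ 0 ⇔ (F S ≡ true × val S ≡ k)
  term≢0⇔ S = ⇔-trans (indicator≢0⇔ _) (⇔-trans T-∧ (T-≡ ×-⇔ mk⇔ (≡ᵇ⇒≡ _ _) (≡⇒≡ᵇ _ _)))

charPoly-val≢0⇔ : ∀ {n} (F : Subset n → Bool) S → charPoly F (val S) ≢ 0 ⇔ F S ≡ true
charPoly-val≢0⇔ F S = ⇔-trans (charPoly≢0⇔ F (val S)) (mk⇔
  (λ (S′ , FS′ , vals) → subst (λ X → F X ≡ true) (val-injective vals) FS′)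
  (λ FS → S , FS , refl))

star≢0⇔ : ∀ n q r {k} → hw k ≤ n →
  star n q r k ≢ 0 ⇔ (∃[ a ] a ≤ k × hw a + hw (k ∸ a) ≡ hw k × q a ≢ 0 × r (k ∸ a) ≢ 0)
star≢0⇔ n q r {k} hw[k]≤n = ⇔-trans (rep≢0⇔ coefficients k) (⇔-trans (sum≢0⇔ _) (mk⇔ factor unfactor))
  where
  coefficients : Poly
  coefficients k′ = sum (concatMap (λ i → map (λ j → Hw (i + j) (Hw i q · Hw j r) k′)
                                              (upTo (suc (n ∸ i))))
                                   (upTo (suc n)))
  term : ℕ → ℕ → ℕ
  term i j = Hw (i + j) (Hw i q · Hw j r) k
  row : ℕ → List ℕ
  row i = map (term i) (upTo (suc (n ∸ i)))
  Terms : List ℕ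
  Terms = concatMap row (upTo (suc n))
  Factorisation : Set
  Factorisation = ∃[ a ] a ≤ k × hw a + hw (k ∸ a) ≡ hw k × q a ≢ 0 × r (k ∸ a) ≢ 0
  factor : Any (_≢ 0) Terms → Factorisation
  factor some =
    let i , _ , some-j    = Any.applyUpTo⁻ id {suc n} (Any.concatMap⁻ row some)
        j , _ , term≢0    = to (any-map-upTo⇔ (term i) (suc (n ∸ i))) some-j
        hw[k] , product≢0 = to (Hw≢0⇔ (i + j) (Hw i q · Hw j r) k) term≢0
        a , a≤k , qa , rb = to (·≢0⇔ (Hw i q) (Hw j r) k) product≢0
        hw[a] , qa≢0      = to (Hw≢0⇔ i q a) qa
        hw[k∸a] , rb≢0    = to (Hw≢0⇔ j r (k ∸ a)) rb
    in a , a≤k , trans (cong₂ _+_ hw[a] hw[k∸a]) (sym hw[k]) , qa≢0 , rb≢0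
  unfactor : Factorisation → Any (_≢ 0) Terms
  unfactor (a , a≤k , hws , qa≢0 , rb≢0) =
    Any.concatMap⁺ row (Any.applyUpTo⁺ id row-i i<1+n)
    where
    i j : ℕ
    i = hw a
    j = hw (k ∸ a)
    i+j≤n : i + j ≤ n
    i+j≤n = subst (_≤ n) (sym hws) hw[k]≤n
    i<1+n : i < suc n
    i<1+n = s≤s (m+n≤o⇒m≤o i i+j≤n)
    j<1+n∸i : j < suc (n ∸ i)
    j<1+n∸i = s≤s (subst (_≤ n ∸ i) (m+n∸m≡n i j) (∸-monoˡ-≤ i i+j≤n))
    term≢0 : term i j ≢ 0
    term≢0 = from (Hw≢0⇔ (i + j) (Hw i q · Hw j r) k) (sym hws , from (·≢0⇔ (Hw i q) (Hw j r) k)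
               (a , a≤k , from (Hw≢0⇔ i q a) (refl , qa≢0) , from (Hw≢0⇔ j r (k ∸ a)) (refl , rb≢0)))
    row-i : Any (_≢ 0) (row i)
    row-i = from (any-map-upTo⇔ (term i) (suc (n ∸ i))) (j , j<1+n∸i , term≢0)

∪≡⊥⇒≡⊥ˡ : ∀ {n} (X Y : Subset n) → X ∪ Y ≡ ⊥ → X ≡ ⊥
∪≡⊥⇒≡⊥ˡ []          []      _  = refl
∪≡⊥⇒≡⊥ˡ (false ∷ X) (y ∷ Y) eq = cong (false ∷_) (∪≡⊥⇒≡⊥ˡ X Y (∷-injectiveʳ eq))

∪≡⊥⇒≡⊥ʳ : ∀ {n} (X Y : Subset n) → X ∪ Y ≡ ⊥ → Y ≡ ⊥
∪≡⊥⇒≡⊥ʳ X Y eq = ∪≡⊥⇒≡⊥ˡ Y X (trans (∪-comm Y X) eq)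

disjoint-⋃⁺ : ∀ {n ℓ} (B : Subset n) (T : Fin ℓ → Subset n) →
              (∀ i → B ∩ T i ≡ ⊥) → B ∩ ⋃ (tabulate T) ≡ ⊥
disjoint-⋃⁺ {ℓ = zero}  B T _        = ∩-zeroʳ B
disjoint-⋃⁺ {ℓ = suc ℓ} B T disjoint = begin
  B ∩ (T fzero ∪ ⋃ (tabulate (T ∘ fsuc)))       ≡⟨ ∩-distribˡ-∪ B _ _ ⟩
  (B ∩ T fzero) ∪ (B ∩ ⋃ (tabulate (T ∘ fsuc)))
                                                ≡⟨ cong₂ _∪_ (disjoint fzero) (disjoint-⋃⁺ B (T ∘ fsuc) (disjoint ∘ fsuc)) ⟩
  ⊥ ∪ ⊥                                         ≡⟨ ∪-identityˡ ⊥ ⟩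
  ⊥                                             ∎
  where open ≡-Reasoning

disjoint-⋃⁻ : ∀ {n ℓ} (B : Subset n) (T : Fin ℓ → Subset n) →
              B ∩ ⋃ (tabulate T) ≡ ⊥ → ∀ i → B ∩ T i ≡ ⊥
disjoint-⋃⁻ B T disjoint fzero    = ∪≡⊥⇒≡⊥ˡ _ _ (trans (sym (∩-distribˡ-∪ B _ _)) disjoint)
disjoint-⋃⁻ B T disjoint (fsuc i) =
  disjoint-⋃⁻ B (T ∘ fsuc) (∪≡⊥⇒≡⊥ʳ _ _ (trans (sym (∩-distribˡ-∪ B _ _)) disjoint)) i

disjointUnion-one⇔ : ∀ {n} (F : Subset n → Bool) W → IsDisjointUnionOf F 1 W ⇔ F W ≡ true
disjointUnion-one⇔ F W = mk⇔
  (λ (S , FS , _ , ⋃S≡W) → subst (λ X → F X ≡ true) (trans (sym (∪-identityʳ (S fzero))) ⋃S≡W) (FS fzero))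
  (λ FW → (λ _ → W) , (λ _ → FW) , (λ { fzero fzero 0≢0 → ⊥-elim (0≢0 refl) }) , ∪-identityʳ W)

disjointUnion-suc⇔ : ∀ {n} (F : Subset n → Bool) ℓ W →
  IsDisjointUnionOf F (suc ℓ) W ⇔
  (∃₂ λ A B → IsDisjointUnionOf F ℓ A × F B ≡ true × A ∩ B ≡ ⊥ × A ∪ B ≡ W)
disjointUnion-suc⇔ {n} F ℓ W = mk⇔ uncons cons
  where
  uncons : IsDisjointUnionOf F (suc ℓ) W →
           ∃₂ λ A B → IsDisjointUnionOf F ℓ A × F B ≡ true × A ∩ B ≡ ⊥ × A ∪ B ≡ W
  uncons (S , FS , disjoint , ⋃S≡W) =
    ⋃ (tabulate (S ∘ fsuc)) , S fzero ,
    (S ∘ fsuc , FS ∘ fsuc , (λ i j i≢j → disjoint (fsuc i) (fsuc j) (i≢j ∘ fsuc-injective)) , refl) ,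
    FS fzero ,
    trans (∩-comm _ (S fzero))
          (disjoint-⋃⁺ (S fzero) (S ∘ fsuc) (λ i → disjoint fzero (fsuc i) (λ ()))) ,
    trans (∪-comm _ (S fzero)) ⋃S≡W
  cons : (∃₂ λ A B → IsDisjointUnionOf F ℓ A × F B ≡ true × A ∩ B ≡ ⊥ × A ∪ B ≡ W) →
         IsDisjointUnionOf F (suc ℓ) W
  cons (A , B , (S , FS , disjoint , ⋃S≡A) , FB , A∩B≡⊥ , A∪B≡W) =
    S′ , FS′ , disjoint′ , trans (cong (B ∪_) ⋃S≡A) (trans (∪-comm B A) A∪B≡W)
    where
    S′ : Fin (suc ℓ) → Subset n
    S′ fzero    = B
    S′ (fsuc i) = S i
    FS′ : ∀ i → F (S′ i) ≡ true
    FS′ fzero    = FB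
    FS′ (fsuc i) = FS i
    B∩S≡⊥ : ∀ i → B ∩ S i ≡ ⊥
    B∩S≡⊥ = disjoint-⋃⁻ B S (trans (cong (B ∩_) ⋃S≡A) (trans (∩-comm B A) A∩B≡⊥))
    disjoint′ : ∀ i j → i ≢ j → S′ i ∩ S′ j ≡ ⊥
    disjoint′ fzero    fzero    i≢j = ⊥-elim (i≢j refl)
    disjoint′ fzero    (fsuc j) _   = B∩S≡⊥ j
    disjoint′ (fsuc i) fzero    _   = trans (∩-comm (S i) B) (B∩S≡⊥ i)
    disjoint′ (fsuc i) (fsuc j) i≢j = disjoint i j (i≢j ∘ cong fsuc)

∃₂-⇔-cong : ∀ {X : Set} {P P′ Q Q′ : X → Set} {R : X → X → Set} →
            (∀ A → P A ⇔ P′ A) → (∀ B → Q B ⇔ Q′ B) →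
            (∃₂ λ A B → P A × Q B × R A B) ⇔ (∃₂ λ A B → P′ A × Q′ B × R A B)
∃₂-⇔-cong P⇔P′ Q⇔Q′ = mk⇔
  (λ (A , B , p , q , r) → A , B , to (P⇔P′ A) p , to (Q⇔Q′ B) q , r)
  (λ (A , B , p , q , r) → A , B , from (P⇔P′ A) p , from (Q⇔Q′ B) q , r)

disjointUnion⇔power : ∀ n (F : Subset n → Bool) m W →
  IsDisjointUnionOf F (suc m) W ⇔ (power n (charPoly F) (suc m) (val W) ≢ 0)
disjointUnion⇔power n F zero W = ⇔-trans (disjointUnion-one⇔ F W) (⇔-sym (charPoly-val≢0⇔ F W))
disjointUnion⇔power n F (suc m) W =
  ⇔-trans (disjointUnion-suc⇔ F (suc m) W)
  (⇔-trans (∃₂-⇔-cong (disjointUnion⇔power n F m) (λ B → ⇔-sym (charPoly-val≢0⇔ F B)))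
  (⇔-trans (disjoint-split⇔carry-free-split (λ a → q a ≢ 0) (λ b → p b ≢ 0) W)
           (⇔-sym (star≢0⇔ n q p (hw-val≤n W)))))
  where
  p q : Poly
  p = charPoly F
  q = power n p (suc m)

mainTheorem16 : (n : ℕ) (F : Subset n → Bool) (ℓ : ℕ) → 1 ≤ ℓ →
    (W : Subset n) →
    IsDisjointUnionOf F ℓ W ⇔ (power n (charPoly F) ℓ (val W) ≢ 0)
mainTheorem16 n F (suc m) _ W = disjointUnion⇔power n F m W
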